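{- Let $q=p^k$ be an odd prime power and let $X$ be a cubic arc-transitive graph of type $\{1,2^1\}$ whose full automorphism group is $G^*=\mathrm{PGL}(2,q)$, such that $G=\mathrm{PSL}(2,q)\le G^*$ is a $1$-arc-regular subgroup of automorphisms. Then no vertex-stabilizer of $G^*$ (acting on the vertices of $X$) is contained in $\mathrm{PSL}(2,q)$. In particular, if $q=3^k$, then $k$ is odd.
   Context: An $s$-arc is a sequence $(u_0,\dots,u_s)$ of distinct vertices with consecutive ones adjacent; a group is $s$-arc-regular if it acts regularly on $s$-arcs. A cubic arc-transitive graph $X$ is of type $\{1,2^1\}$ if its full automorphism group acts regularly on $2$-arcs, it has a subgroup acting regularly on arcs, and the edge stabilizer in $\mathrm{Aut}(X)$ is isomorphic to $\mathbb{Z}_2^2$. -}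

module Defs where

open import Data.Nat using (ℕ; suc)
import Data.Nat as ℕ
open import Data.Fin using (Fin)
open import Data.Bool using (Bool; true; _xor_)
open import Data.Bool.Properties using () renaming (_≟_ to _≟B_)
open import Data.List using (List; filter; length; allFin)
open import Data.Product using (Σ; ∃; _×_; _,_)
open import Data.Sum using (_⊎_)
open import Relation.Nullary using (¬_)
open import Relation.Binary.PropositionalEquality using (_≡_)
open import Algebra.Structures using (IsCommutativeRing)

Odd : ℕ → Set
Odd k = ∃ λ m → k ≡ suc (2 ℕ.* m)

-- A finite field with q elements: a field structure (propositional
-- equality) on the carrier Fin q.  All fields of order q are isomorphic,
-- so GF(q) is "any" such structure.

record FiniteField (q : ℕ) : Set where
  infixl 6 _+_
  infixl 7 _*_
  field
    _+_ _*_    : Fin q → Fin q → Fin q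
    -_         : Fin q → Fin q
    0# 1#      : Fin q
    _⁻¹        : Fin q → Fin q
    isCommRing : IsCommutativeRing _≡_ _+_ _*_ -_ 0# 1#
    0≢1        : ¬ (0# ≡ 1#)
    inverseʳ   : ∀ x → ¬ (x ≡ 0#) → x * (x ⁻¹) ≡ 1#

record Graph (n : ℕ) : Set where
  field
    E      : Fin n → Fin n → Bool
    sym    : ∀ u v → E u v ≡ E v u
    irrefl : ∀ v → ¬ (E v v ≡ true)

module _ {n : ℕ} (X : Graph n) where
  open Graph X

  Adj : Fin n → Fin n → Set
  Adj u v = E u v ≡ true

  degree : Fin n → ℕ
  degree v = length (filter (λ w → E v w ≟B true) (allFin n))

  Cubic : Set
  Cubic = ∀ v → degree v ≡ 3

  data Reach : Fin n → Fin n → Set where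
    here  : ∀ {u} → Reach u u
    there : ∀ {u v w} → Adj u v → Reach v w → Reach u w

  Connected : Set
  Connected = ∀ u v → Reach u v

  IsAut : (Fin n → Fin n) → Set
  IsAut σ = (∃ λ (τ : Fin n → Fin n) → (∀ v → σ (τ v) ≡ v) × (∀ v → τ (σ v) ≡ v))
          × (∀ u v → E (σ u) (σ v) ≡ E u v)

  -- 2-arcs (u0,u1,u2): consecutive adjacent, all distinct
  -- (u0 ≠ u1, u1 ≠ u2 follow from irreflexivity)
  Is2Arc : Fin n → Fin n → Fin n → Set
  Is2Arc u₀ u₁ u₂ = Adj u₀ u₁ × Adj u₁ u₂ × ¬ (u₀ ≡ u₂)

module Matrices {q : ℕ} (F : FiniteField q) where
  open FiniteField F

  record Mat : Set where
    constructor mat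
    field a b c d : Fin q

  det : Mat → Fin q
  det (mat a b c d) = a * d + - (b * c)

  _·_ : Mat → Mat → Mat
  mat a b c d · mat a' b' c' d' =
    mat (a * a' + b * c') (a * b' + b * d') (c * a' + d * c') (c * b' + d * d')

  I₂ : Mat
  I₂ = mat 1# 0# 0# 1#

  scale : Fin q → Mat → Mat
  scale s (mat a b c d) = mat (s * a) (s * b) (s * c) (s * d)

  Inv : Mat → Set
  Inv A = ¬ (det A ≡ 0#)

  -- equality in PGL(2,q) = GL(2,q)/scalars
  _~_ : Mat → Mat → Set
  A ~ B = ∃ λ s → ¬ (s ≡ 0#) × B ≡ scale s A

  IsSquare : Fin q → Set
  IsSquare x = ∃ λ s → x ≡ s * s

  -- PSL(2,q) as a subgroup of PGL(2,q): classes of matrices whose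
  -- determinant is a square (well defined, since det (sA) = s² det A)
  InPSL : Mat → Set
  InPSL A = IsSquare (det A)

  -- subgroups of PGL(2,q), given as predicates on GL(2,q) closed under ~
  record Subgroup : Set₁ where
    field
      H      : Mat → Set
      ⊆Inv   : ∀ A → H A → Inv A
      resp~  : ∀ A B → A ~ B → H A → H B
      hasId  : H I₂
      closed : ∀ A B → H A → H B → H (A · B)
      invs   : ∀ A → H A → ∃ λ B → H B × (A · B) ~ I₂

-- X has full automorphism group PGL(2,q): a faithful action of PGL(2,q)
-- on the vertices by automorphisms whose image is all of Aut(X).

module _ {q n : ℕ} (F : FiniteField q) (X : Graph n) where
  open Matrices F
  open Graph X

  record PGLisAut : Set where
    field
      ρ        : Mat → Fin n → Fin n
      ρ-resp   : ∀ A B → Inv A → Inv B → A ~ B → ∀ v → ρ A v ≡ ρ B v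
      ρ-id     : ∀ v → ρ I₂ v ≡ v
      ρ-hom    : ∀ A B → Inv A → Inv B → ∀ v → ρ (A · B) v ≡ ρ A (ρ B v)
      ρ-aut    : ∀ A → Inv A → ∀ u v → E (ρ A u) (ρ A v) ≡ E u v
      faithful : ∀ A → Inv A → (∀ v → ρ A v ≡ v) → A ~ I₂
      full     : ∀ σ → IsAut X σ → ∃ λ A → Inv A × (∀ v → ρ A v ≡ σ v)

  module _ (act : PGLisAut) where
    open PGLisAut act

    -- a set S of group elements (predicate on GL(2,q), intended up to ~)
    -- acts regularly on 2-arcs
    Regular2Arcs : (Mat → Set) → Set
    Regular2Arcs S =
      ∀ u₀ u₁ u₂ w₀ w₁ w₂ → Is2Arc X u₀ u₁ u₂ → Is2Arc X w₀ w₁ w₂ →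
        (∃ λ A → S A × ρ A u₀ ≡ w₀ × ρ A u₁ ≡ w₁ × ρ A u₂ ≡ w₂)
        × (∀ A B → S A → S B →
             ρ A u₀ ≡ w₀ → ρ A u₁ ≡ w₁ → ρ A u₂ ≡ w₂ →
             ρ B u₀ ≡ w₀ → ρ B u₁ ≡ w₁ → ρ B u₂ ≡ w₂ → A ~ B)

    RegularArcs : (Mat → Set) → Set
    RegularArcs S =
      ∀ u₀ u₁ w₀ w₁ → Adj X u₀ u₁ → Adj X w₀ w₁ →
        (∃ λ A → S A × ρ A u₀ ≡ w₀ × ρ A u₁ ≡ w₁)
        × (∀ A B → S A → S B →
             ρ A u₀ ≡ w₀ → ρ A u₁ ≡ w₁ →
             ρ B u₀ ≡ w₀ → ρ B u₁ ≡ w₁ → A ~ B)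

    StabEdge : Fin n → Fin n → Mat → Set
    StabEdge u v A = (ρ A u ≡ u × ρ A v ≡ v) ⊎ (ρ A u ≡ v × ρ A v ≡ u)

    -- the edge stabilizer in Aut(X) = PGL(2,q) is isomorphic to Z₂ × Z₂
    -- (Z₂ × Z₂ realised as Bool × Bool under componentwise xor)
    EdgeStabZ2² : Fin n → Fin n → Set
    EdgeStabZ2² u v =
      Σ (Bool × Bool → Mat) λ f →
          (∀ x → Inv (f x))
        × (∀ x₁ x₂ y₁ y₂ → f (x₁ xor y₁ , x₂ xor y₂) ~ (f (x₁ , x₂) · f (y₁ , y₂)))
        × (∀ x y → f x ~ f y → x ≡ y)
        × (∀ x → StabEdge u v (f x))
        × (∀ A → Inv A → StabEdge u v A → ∃ λ x → A ~ f x)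

    Type1-2¹ : Set₁
    Type1-2¹ = Regular2Arcs Inv
             × (Σ Subgroup λ H → RegularArcs (Subgroup.H H))
             × (∀ u v → Adj X u v → EdgeStabZ2² u v)

    PSLArcRegular : Set
    PSLArcRegular = RegularArcs (λ A → Inv A × InPSL A)

    StabInPSL : Fin n → Set
    StabInPSL v = ∀ A → Inv A → ρ A v ≡ v → InPSL A

module Submission where

-- Let v be a vertex with neighbours a, b, c. By 2-arc-regularity some element of PGL(2,q) fixes v
-- and c and maps a to b; it fixes the arc (v, c) without being trivial, so it is not in the
-- arc-regular subgroup PSL(2,q).
--
-- Let now q = 3^k. The stabiliser of v contains the involution t swapping a and b and the element
-- r of order 3 rotating a ↦ b ↦ c, and t r is again an involution. In characteristic 3, r is
-- unipotent: its traceless part is a non-zero isotropic vector of the quadratic form -det on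
-- traceless matrices, and it is orthogonal to t since tr (t r) = 0. Hence -det t is a square. As
-- t ∉ PSL(2,q), det t is not a square, so -1 is not a square in GF(q), i.e. q ≡ 3 (mod 4). Since
-- 9^m ≡ 1 (mod 4), k is odd.

open import Defs
open import Level using (0ℓ)
open import Function using (_∘_; case_of_; _⇔_; mk⇔)
open import Data.Empty using (⊥-elim)
open import Data.Bool using (Bool; true; false; not; _∧_; if_then_else_)
open import Data.Bool.Properties using () renaming (_≟_ to _≟ᵇ_)
open import Data.Nat using (ℕ; zero; suc; _^_; _%_; _≤_)
import Data.Nat as ℕ
open import Data.Nat.Properties using (+-0-commutativeMonoid)
open import Data.Nat.DivMod using ([m+kn]%n≡m%n)
open import Data.Nat.Primality using (Prime)
open import Data.Nat.Tactic.RingSolver using (solve-∀)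
open import Data.Fin as Fin using (Fin; _≟_)
open import Data.Fin.Properties using (_<?_; <-cmp; <-irrefl)
open import Data.Fin.Permutation using (permutation)
open import Data.List using (List; []; _∷_; filter; length; allFin)
open import Data.List.Membership.Propositional using (_∈_)
open import Data.List.Membership.Propositional.Properties using (∈-filter⁺; ∈-filter⁻; ∈-allFin)
open import Data.List.Relation.Unary.Any using (here; there)
open import Data.List.Relation.Unary.All using ([]; _∷_)
open import Data.List.Relation.Unary.AllPairs using ([]; _∷_)
open import Data.List.Relation.Unary.Unique.Propositional using (Unique)
import Data.List.Relation.Unary.Unique.Propositional.Properties as Unique
open import Data.Maybe using (Maybe; just; nothing)
open import Data.Product using (_×_; _,_; ∃; proj₁; proj₂; map₂)
open import Data.Sum using (_⊎_; inj₁; inj₂; reduce)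
open import Relation.Nullary using (¬_; does; yes; no)
open import Relation.Nullary.Decidable using (dec-true; dec-false; does-⇔)
open import Relation.Binary using (tri<; tri≈; tri>)
open import Relation.Binary.PropositionalEquality
open import Algebra.Bundles using (CommutativeRing; RawRing)
open import Algebra.Structures using (IsCommutativeRing)
open import Algebra.Solver.Ring.AlmostCommutativeRing using (_-Raw-AlmostCommutative⟶_; fromCommutativeRing)
import Algebra.Properties.Ring as RingProperties
import Algebra.Properties.CommutativeMonoid.Sum as CommutativeMonoidSum
import Algebra.Properties.Semiring.Mult as SemiringMult
import Algebra.Solver.Ring as RingSolver

module Counting where
  open import Data.Nat using (_+_)
  open CommutativeMonoidSum +-0-commutativeMonoid using (sum; sum-cong-≗; ∑-distrib-+; sum-permute; sum-replicate-zero)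
  open ≡-Reasoning

  indicator : Bool → ℕ
  indicator b = if b then 1 else 0

  indicator-+-not : ∀ b → indicator b + indicator (not b) ≡ 1
  indicator-+-not true  = refl
  indicator-+-not false = refl

  count : ∀ {n} → (Fin n → Bool) → ℕ
  count P = sum (λ x → indicator (P x))

  count-true : ∀ {n} → count {n} (λ _ → true) ≡ n
  count-true {zero}  = refl
  count-true {suc n} = cong suc (count-true {n})

  count-cong : ∀ {n} {P Q : Fin n → Bool} → (∀ x → P x ≡ Q x) → count P ≡ count Q
  count-cong P≗Q = sum-cong-≗ (λ x → cong indicator (P≗Q x))

  count-≟ : ∀ {n} (e : Fin n) → count (λ x → does (x ≟ e)) ≡ 1
  count-≟ {suc n} Fin.zero    = cong suc (sum-replicate-zero n)
  count-≟ {suc n} (Fin.suc e) = count-≟ e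

  infix 4 _<ᵇ_
  _<ᵇ_ : ∀ {n} → Fin n → Fin n → Bool
  x <ᵇ y = does (x <? y)

  <ᵇ-irrefl : ∀ {n} (x : Fin n) → (x <ᵇ x) ≡ false
  <ᵇ-irrefl x = dec-false (x <? x) (<-irrefl refl)

  <ᵇ-flip : ∀ {n} {x y : Fin n} → ¬ (x ≡ y) → (y <ᵇ x) ≡ not (x <ᵇ y)
  <ᵇ-flip {x = x} {y} x≢y with <-cmp x y
  ... | tri< x<y _ y≮x = trans (dec-false (y <? x) y≮x) (cong not (sym (dec-true (x <? y) x<y)))
  ... | tri≈ _ x≡y _   = ⊥-elim (x≢y x≡y)
  ... | tri> x≮y _ y<x = trans (dec-true (y <? x) y<x) (cong not (sym (dec-false (x <? y) x≮y)))

  -- Every orbit {x, g x} of size two is counted once, at its smaller element.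
  count-involution : ∀ {n} (g : Fin n → Fin n) → (∀ x → g (g x) ≡ x) →
    (S : Fin n → Bool) → (∀ x → S (g x) ≡ S x) →
    count S ≡ count (λ x → S x ∧ does (g x ≟ x))
              + (count (λ x → S x ∧ (x <ᵇ g x)) + count (λ x → S x ∧ (x <ᵇ g x)))
  count-involution {n} g g∘g≗id S S∘g≗S = begin
    count S
      ≡⟨ sum-cong-≗ split ⟩
    sum (λ x → indicator (Fix x) + (indicator (Low x) + indicator (Low (g x))))
      ≡⟨ ∑-distrib-+ (indicator ∘ Fix) (λ x → indicator (Low x) + indicator (Low (g x))) ⟩
    count Fix + sum (λ x → indicator (Low x) + indicator (Low (g x)))
      ≡⟨ cong (count Fix +_) (∑-distrib-+ (indicator ∘ Low) (indicator ∘ Low ∘ g)) ⟩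
    count Fix + (count Low + sum (indicator ∘ Low ∘ g))
      ≡⟨ cong (λ m → count Fix + (count Low + m))
              (sum-permute (indicator ∘ Low) (permutation g g g∘g≗id g∘g≗id)) ⟨
    count Fix + (count Low + count Low)
      ∎
    where
    Fix Low : Fin n → Bool
    Fix x = S x ∧ does (g x ≟ x)
    Low x = S x ∧ (x <ᵇ g x)
    split : ∀ x → indicator (S x) ≡ indicator (Fix x) + (indicator (Low x) + indicator (Low (g x)))
    split x rewrite S∘g≗S x | g∘g≗id x with S x | g x ≟ x
    ... | false | _        = refl
    ... | true  | yes gx≡x rewrite gx≡x | <ᵇ-irrefl x = refl
    ... | true  | no  gx≢x = sym (begin
      indicator (x <ᵇ g x) + indicator (g x <ᵇ x)
        ≡⟨ cong (λ b → indicator (x <ᵇ g x) + indicator b) (<ᵇ-flip (gx≢x ∘ sym)) ⟩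
      indicator (x <ᵇ g x) + indicator (not (x <ᵇ g x))
        ≡⟨ indicator-+-not (x <ᵇ g x) ⟩
      1 ∎)

3^[2+k]%4≡3^k%4 : ∀ k → 3 ^ (2 ℕ.+ k) % 4 ≡ 3 ^ k % 4
3^[2+k]%4≡3^k%4 k = trans (cong (_% 4) (9x≡x+2x·4 (3 ^ k))) ([m+kn]%n≡m%n (3 ^ k) (2 ℕ.* 3 ^ k) 4)
  where
  9x≡x+2x·4 : ∀ x → 3 ℕ.* (3 ℕ.* x) ≡ x ℕ.+ 2 ℕ.* x ℕ.* 4
  9x≡x+2x·4 = solve-∀

3^k%4≡3⇒odd : ∀ k → 3 ^ k % 4 ≡ 3 → Odd k
3^k%4≡3⇒odd 0             ()
3^k%4≡3⇒odd 1             _ = 0 , refl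
3^k%4≡3⇒odd (suc (suc k)) 3^[2+k]%4≡3 with 3^k%4≡3⇒odd k (trans (sym (3^[2+k]%4≡3^k%4 k)) 3^[2+k]%4≡3)
... | m , refl = suc m , 3+2m≡1+2[1+m] m
  where
  3+2m≡1+2[1+m] : ∀ m → suc (suc (suc (2 ℕ.* m))) ≡ suc (2 ℕ.* suc m)
  3+2m≡1+2[1+m] = solve-∀

module FieldProperties {q : ℕ} (F : FiniteField q) where
  open FiniteField F public
  open IsCommutativeRing isCommRing public
    using (+-assoc; +-comm; +-identityˡ; +-identityʳ; -‿inverseˡ; -‿inverseʳ;
           *-assoc; *-comm; *-identityˡ; *-identityʳ; zeroˡ; zeroʳ; distribˡ; distribʳ)

  commutativeRing : CommutativeRing 0ℓ 0ℓ
  commutativeRing = record { isCommutativeRing = isCommRing }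

  open CommutativeRing commutativeRing using (ring; semiring; +-commutativeMonoid)
  open RingProperties ring public
    using (-‿involutive; -0#≈0#; -‿distribˡ-*; -‿distribʳ-*; -1*x≈-x;
           +-inverseʳ-unique; +-identityʳ-unique; x∙y⁻¹≈ε⇒x≈y; x≈y⇒x∙y⁻¹≈ε)
  open SemiringMult semiring public using (×1-homo-*) renaming (_×_ to _×ᵣ_)
  open ≡-Reasoning

  1≢0 : ¬ (1# ≡ 0#)
  1≢0 1≡0 = 0≢1 (sym 1≡0)

  inverseˡ : ∀ x → ¬ (x ≡ 0#) → x ⁻¹ * x ≡ 1#
  inverseˡ x x≢0 = trans (*-comm (x ⁻¹) x) (inverseʳ x x≢0)

  *-cancelˡ-nonzero : ∀ s {x y} → ¬ (s ≡ 0#) → s * x ≡ s * y → x ≡ y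
  *-cancelˡ-nonzero s {x} {y} s≢0 sx≡sy = begin
    x                ≡⟨ unscale x ⟨
    s ⁻¹ * (s * x)   ≡⟨ cong (s ⁻¹ *_) sx≡sy ⟩
    s ⁻¹ * (s * y)   ≡⟨ unscale y ⟩
    y                ∎
    where
    unscale : ∀ z → s ⁻¹ * (s * z) ≡ z
    unscale z = begin
      s ⁻¹ * (s * z)  ≡⟨ *-assoc (s ⁻¹) s z ⟨
      s ⁻¹ * s * z    ≡⟨ cong (_* z) (inverseˡ s s≢0) ⟩
      1# * z          ≡⟨ *-identityˡ z ⟩
      z               ∎

  x*y≡0⇒x≡0⊎y≡0 : ∀ x y → x * y ≡ 0# → x ≡ 0# ⊎ y ≡ 0#
  x*y≡0⇒x≡0⊎y≡0 x y xy≡0 with x ≟ 0#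
  ... | yes x≡0 = inj₁ x≡0
  ... | no  x≢0 = inj₂ (*-cancelˡ-nonzero x x≢0 (trans xy≡0 (sym (zeroʳ x))))

  x≢0∧y≢0⇒x*y≢0 : ∀ {x y} → ¬ (x ≡ 0#) → ¬ (y ≡ 0#) → ¬ (x * y ≡ 0#)
  x≢0∧y≢0⇒x*y≢0 {x} {y} x≢0 y≢0 xy≡0 with x*y≡0⇒x≡0⊎y≡0 x y xy≡0
  ... | inj₁ x≡0 = x≢0 x≡0
  ... | inj₂ y≡0 = y≢0 y≡0

  -‿nonzero : ∀ {x} → ¬ (x ≡ 0#) → ¬ (- x ≡ 0#)
  -‿nonzero {x} x≢0 -x≡0 = x≢0 (trans (sym (-‿involutive x)) (trans (cong -_ -x≡0) -0#≈0#))

  ⁻¹-nonzero : ∀ {x} → ¬ (x ≡ 0#) → ¬ (x ⁻¹ ≡ 0#)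
  ⁻¹-nonzero {x} x≢0 x⁻¹≡0 = 1≢0 (begin
    1#         ≡⟨ inverseʳ x x≢0 ⟨
    x * x ⁻¹   ≡⟨ cong (x *_) x⁻¹≡0 ⟩
    x * 0#     ≡⟨ zeroʳ x ⟩
    0#         ∎)

  ⁻¹-unique : ∀ {x y} → ¬ (x ≡ 0#) → x * y ≡ 1# → y ≡ x ⁻¹
  ⁻¹-unique {x} x≢0 xy≡1 = *-cancelˡ-nonzero x x≢0 (trans xy≡1 (sym (inverseʳ x x≢0)))

  ⁻¹-involutive : ∀ {x} → ¬ (x ≡ 0#) → x ⁻¹ ⁻¹ ≡ x
  ⁻¹-involutive {x} x≢0 = sym (⁻¹-unique (⁻¹-nonzero x≢0) (inverseˡ x x≢0))

  1⁻¹≡1 : 1# ⁻¹ ≡ 1#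
  1⁻¹≡1 = sym (⁻¹-unique 1≢0 (*-identityʳ 1#))

  -x*-y≡x*y : ∀ x y → - x * - y ≡ x * y
  -x*-y≡x*y x y = begin
    - x * - y       ≡⟨ -‿distribˡ-* x (- y) ⟨
    - (x * - y)     ≡⟨ cong -_ (-‿distribʳ-* x y) ⟨
    - (- (x * y))   ≡⟨ -‿involutive (x * y) ⟩
    x * y           ∎

  ⁻¹-neg : ∀ {x} → ¬ (x ≡ 0#) → (- x) ⁻¹ ≡ - (x ⁻¹)
  ⁻¹-neg {x} x≢0 = sym (⁻¹-unique (-‿nonzero x≢0) (trans (-x*-y≡x*y x (x ⁻¹)) (inverseʳ x x≢0)))

  x*x≡1⇒x≡±1 : ∀ {x} → x * x ≡ 1# → x ≡ 1# ⊎ x ≡ - 1#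
  x*x≡1⇒x≡±1 {x} xx≡1 with x*y≡0⇒x≡0⊎y≡0 (x + - 1#) (x + 1#) (begin
    (x + - 1#) * (x + 1#)           ≡⟨ distribʳ (x + 1#) x (- 1#) ⟩
    x * (x + 1#) + - 1# * (x + 1#)  ≡⟨ cong₂ _+_ (distribˡ x x 1#) (-1*x≈-x (x + 1#)) ⟩
    (x * x + x * 1#) + - (x + 1#)   ≡⟨ cong₂ (λ u v → (u + v) + - (x + 1#)) xx≡1 (*-identityʳ x) ⟩
    (1# + x) + - (x + 1#)           ≡⟨ cong (_+ - (x + 1#)) (+-comm 1# x) ⟩
    (x + 1#) + - (x + 1#)           ≡⟨ -‿inverseʳ (x + 1#) ⟩
    0#                              ∎)
  ... | inj₁ x-1≡0 = inj₁ (x∙y⁻¹≈ε⇒x≈y x 1# x-1≡0)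
  ... | inj₂ x+1≡0 = inj₂ (+-inverseʳ-unique 1# x (trans (+-comm 1# x) x+1≡0))

  -- Summing all elements of F is invariant under the translation y ↦ y + 1.
  q×ᵣ1≡0 : q ×ᵣ 1# ≡ 0#
  q×ᵣ1≡0 = +-identityʳ-unique (sum id) (q ×ᵣ 1#) (begin
    sum id + q ×ᵣ 1#             ≡⟨ cong (sum id +_) (sum-replicate q) ⟨
    sum id + sum {q} (λ _ → 1#)  ≡⟨ ∑-distrib-+ id (λ _ → 1#) ⟨
    sum (λ y → y + 1#)           ≡⟨ sum-permute id translation ⟨
    sum id                       ∎)
    where
    open CommutativeMonoidSum +-commutativeMonoid using (sum; sum-replicate; ∑-distrib-+; sum-permute)
    id : Fin q → Fin q
    id y = y
    y+u-u≡y : ∀ y u → y + u + - u ≡ y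
    y+u-u≡y y u = trans (+-assoc y u (- u)) (trans (cong (y +_) (-‿inverseʳ u)) (+-identityʳ y))
    translation = permutation (_+ 1#) (_+ - 1#)
      (λ y → trans (cong (λ u → y + - 1# + u) (sym (-‿involutive 1#))) (y+u-u≡y y (- 1#)))
      (λ y → y+u-u≡y y 1#)

  ^×ᵣ1≡0⇒×ᵣ1≡0 : ∀ m k → (m ^ k) ×ᵣ 1# ≡ 0# → m ×ᵣ 1# ≡ 0#
  ^×ᵣ1≡0⇒×ᵣ1≡0 m zero    1+0≡0 = ⊥-elim (1≢0 (trans (sym (+-identityʳ 1#)) 1+0≡0))
  ^×ᵣ1≡0⇒×ᵣ1≡0 m (suc k) mᵏ⁺¹≡0
    with x*y≡0⇒x≡0⊎y≡0 (m ×ᵣ 1#) ((m ^ k) ×ᵣ 1#) (trans (sym (×1-homo-* m (m ^ k))) mᵏ⁺¹≡0)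
  ... | inj₁ m≡0  = m≡0
  ... | inj₂ mᵏ≡0 = ^×ᵣ1≡0⇒×ᵣ1≡0 m k mᵏ≡0

module MatrixProperties {q : ℕ} (F : FiniteField q) where
  open FieldProperties F
  open Matrices F public
  open ≡-Reasoning

  mat-cong : ∀ {a b c d a′ b′ c′ d′} → a ≡ a′ → b ≡ b′ → c ≡ c′ → d ≡ d′ →
             mat a b c d ≡ mat a′ b′ c′ d′
  mat-cong refl refl refl refl = refl

  det-unitriangular : ∀ x → det (mat 1# x 0# 1#) ≡ 1#
  det-unitriangular x = begin
    1# * 1# + - (x * 0#)  ≡⟨ cong₂ (λ u v → u + - v) (*-identityʳ 1#) (zeroʳ x) ⟩
    1# + - 0#             ≡⟨ cong (1# +_) -0#≈0# ⟩
    1# + 0#               ≡⟨ +-identityʳ 1# ⟩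
    1#                    ∎

  Inv-unitriangular : ∀ x → Inv (mat 1# x 0# 1#)
  Inv-unitriangular x det≡0 = 1≢0 (trans (sym (det-unitriangular x)) det≡0)

  Inv-I₂ : Inv I₂
  Inv-I₂ = Inv-unitriangular 0#

  InPSL-I₂ : InPSL I₂
  InPSL-I₂ = 1# , trans (det-unitriangular 0#) (sym (*-identityʳ 1#))

  ~I₂⇒scalar : ∀ {a b c d} → mat a b c d ~ I₂ → b ≡ 0# × c ≡ 0# × a ≡ d
  ~I₂⇒scalar (s , s≢0 , I₂≡sM) =
      *-cancelˡ-nonzero s s≢0 (trans (sym (cong Mat.b I₂≡sM)) (sym (zeroʳ s)))
    , *-cancelˡ-nonzero s s≢0 (trans (sym (cong Mat.c I₂≡sM)) (sym (zeroʳ s)))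
    , *-cancelˡ-nonzero s s≢0 (trans (sym (cong Mat.a I₂≡sM)) (cong Mat.d I₂≡sM))

  scalar⇒~I₂ : ∀ {a b c d} → Inv (mat a b c d) → b ≡ 0# → c ≡ 0# → a ≡ d → mat a b c d ~ I₂
  scalar⇒~I₂ {a} M-inv refl refl refl = a ⁻¹ , ⁻¹-nonzero a≢0 ,
    mat-cong (sym (inverseˡ a a≢0)) (sym (zeroʳ (a ⁻¹))) (sym (zeroʳ (a ⁻¹))) (sym (inverseˡ a a≢0))
    where
    a≢0 : ¬ (a ≡ 0#)
    a≢0 refl = M-inv (-‿inverseʳ (0# * 0#))

module _ {n : ℕ} (X : Graph n) where
  open Graph X using (E) renaming (sym to E-sym)

  Adj-sym : ∀ {u w} → Adj X u w → Adj X w u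
  Adj-sym {u} {w} u~w = trans (E-sym w u) u~w

  record Neighbourhood (v : Fin n) : Set where
    field
      a b c : Fin n
      v~a   : Adj X v a
      v~b   : Adj X v b
      v~c   : Adj X v c
      a≢b   : ¬ (a ≡ b)
      a≢c   : ¬ (a ≡ c)
      b≢c   : ¬ (b ≡ c)
      only  : ∀ {w} → Adj X v w → w ≡ a ⊎ w ≡ b ⊎ w ≡ c

  neighbourhood : Cubic X → ∀ v → Neighbourhood v
  neighbourhood cubic v = fromList (filter v~? (allFin n)) (cubic v)
    (Unique.filter⁺ v~? (Unique.allFin⁺ n))
    (λ w∈ → proj₂ (∈-filter⁻ v~? {xs = allFin n} w∈))
    (λ v~w → ∈-filter⁺ v~? (∈-allFin _) v~w)
    where
    v~? = λ w → E v w ≟ᵇ true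
    fromList : (ws : List (Fin n)) → length ws ≡ 3 → Unique ws →
               (∀ {w} → w ∈ ws → Adj X v w) → (∀ {w} → Adj X v w → w ∈ ws) → Neighbourhood v
    fromList (a ∷ b ∷ c ∷ []) refl ((a≢b ∷ a≢c ∷ []) ∷ (b≢c ∷ []) ∷ [] ∷ []) sound complete = record
      { a = a ; b = b ; c = c
      ; v~a = sound (here refl) ; v~b = sound (there (here refl)) ; v~c = sound (there (there (here refl)))
      ; a≢b = a≢b ; a≢c = a≢c ; b≢c = b≢c
      ; only = λ v~w → case complete v~w of λ
          { (here w≡a)                 → inj₁ w≡a
          ; (there (here w≡b))         → inj₂ (inj₁ w≡b)
          ; (there (there (here w≡c))) → inj₂ (inj₂ w≡c) }
      }

module Action {q n : ℕ} (F : FiniteField q) (X : Graph n) (act : PGLisAut F X)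
  (2-arc-regular : Regular2Arcs F X act (Matrices.Inv F)) (PSL-arc-regular : PSLArcRegular F X act) where
  open FieldProperties F
  open MatrixProperties F
  open PGLisAut act

  ~I₂⇒fixes : ∀ {A} → Inv A → A ~ I₂ → ∀ x → ρ A x ≡ x
  ~I₂⇒fixes {A} A-inv A~I₂ x = trans (ρ-resp A I₂ A-inv Inv-I₂ A~I₂ x) (ρ-id x)

  moves⇒≁I₂ : ∀ {A x} → Inv A → ¬ (ρ A x ≡ x) → ¬ (A ~ I₂)
  moves⇒≁I₂ {x = x} A-inv moves A~I₂ = moves (~I₂⇒fixes A-inv A~I₂ x)

  ·-maps : ∀ {A B x y z} → Inv A → Inv B → ρ B x ≡ y → ρ A y ≡ z → ρ (A · B) x ≡ z
  ·-maps {A} {B} A-inv B-inv Bx≡y Ay≡z = trans (ρ-hom A B A-inv B-inv _) (trans (cong (ρ A) Bx≡y) Ay≡z)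

  fixes-2-arc⇒~I₂ : ∀ {x y z} → Is2Arc X x y z →
    ∀ {A} → Inv A → ρ A x ≡ x → ρ A y ≡ y → ρ A z ≡ z → A ~ I₂
  fixes-2-arc⇒~I₂ arc {A} A-inv Ax Ay Az =
    proj₂ (2-arc-regular _ _ _ _ _ _ arc arc) A I₂ A-inv Inv-I₂ Ax Ay Az (ρ-id _) (ρ-id _) (ρ-id _)

  PSL-fixes-arc⇒~I₂ : ∀ {x y} → Adj X x y →
    ∀ {A} → Inv A → InPSL A → ρ A x ≡ x → ρ A y ≡ y → A ~ I₂
  PSL-fixes-arc⇒~I₂ x~y {A} A-inv A∈PSL Ax Ay =
    proj₂ (PSL-arc-regular _ _ _ _ x~y x~y) A I₂ (A-inv , A∈PSL) (Inv-I₂ , InPSL-I₂) Ax Ay (ρ-id _) (ρ-id _)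

  module _ {v : Fin n} (N : Neighbourhood X v) where
    open Neighbourhood N

    2-arc : ∀ {x y} → Adj X v x → Adj X v y → ¬ (x ≡ y) → Is2Arc X x v y
    2-arc v~x v~y x≢y = Adj-sym X v~x , v~y , x≢y

    stabiliser-preserves-neighbourhood : ∀ {A w} → Inv A → ρ A v ≡ v → Adj X v w → Adj X v (ρ A w)
    stabiliser-preserves-neighbourhood {A} {w} A-inv Av≡v v~w =
      trans (cong (λ u → Graph.E X u (ρ A w)) (sym Av≡v)) (trans (ρ-aut A A-inv v w) v~w)

    stabiliser-⊈-PSL : ¬ StabInPSL F X act v
    stabiliser-⊈-PSL stab⊆PSL =
      case proj₁ (2-arc-regular c v a c v b (2-arc v~c v~a (a≢c ∘ sym)) (2-arc v~c v~b (b≢c ∘ sym))) of λ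
        { (B , B-inv , Bc≡c , Bv≡v , Ba≡b) →
            let B~I₂ = PSL-fixes-arc⇒~I₂ v~c B-inv (stab⊆PSL B B-inv Bv≡v) Bv≡v Bc≡c
            in  a≢b (trans (sym (~I₂⇒fixes B-inv B~I₂ a)) Ba≡b) }

-- Coefficients of the ring solver in characteristic 3.
data ℤ₃ : Set where
  0₃ 1₃ 2₃ : ℤ₃

infixl 6 _+₃_
infixl 7 _*₃_

_+₃_ : ℤ₃ → ℤ₃ → ℤ₃
0₃ +₃ y  = y
1₃ +₃ 0₃ = 1₃
1₃ +₃ 1₃ = 2₃
1₃ +₃ 2₃ = 0₃
2₃ +₃ 0₃ = 2₃
2₃ +₃ 1₃ = 0₃
2₃ +₃ 2₃ = 1₃

_*₃_ : ℤ₃ → ℤ₃ → ℤ₃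
0₃ *₃ _  = 0₃
1₃ *₃ y  = y
2₃ *₃ 0₃ = 0₃
2₃ *₃ 1₃ = 2₃
2₃ *₃ 2₃ = 1₃

-₃_ : ℤ₃ → ℤ₃
-₃ 0₃ = 0₃
-₃ 1₃ = 2₃
-₃ 2₃ = 1₃

ℤ₃-rawRing : RawRing 0ℓ 0ℓ
ℤ₃-rawRing = record
  { Carrier = ℤ₃ ; _≈_ = _≡_ ; _+_ = _+₃_ ; _*_ = _*₃_ ; -_ = -₃_ ; 0# = 0₃ ; 1# = 1₃ }

module _ {q : ℕ} (F : FiniteField q) where
  open FieldProperties F

  -- The group generated by x ↦ -x and x ↦ x⁻¹ acts on F ∖ {0} with one orbit {1, -1} of size two
  -- and all other orbits of size four. It is counted through the representatives x with x < -x.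
  module MinusOneNonSquare (-1≢x² : ∀ x → ¬ (x * x ≡ - 1#)) where
    open Counting
    open ≡-Reasoning

    x≡-x⇒x≡0 : ∀ {x} → x ≡ - x → x ≡ 0#
    x≡-x⇒x≡0 {x} x≡-x with x*y≡0⇒x≡0⊎y≡0 (1# + 1#) x (begin
      (1# + 1#) * x    ≡⟨ distribʳ x 1# 1# ⟩
      1# * x + 1# * x  ≡⟨ cong₂ _+_ (*-identityˡ x) (trans (*-identityˡ x) x≡-x) ⟩
      x + - x          ≡⟨ -‿inverseʳ x ⟩
      0#               ∎)
    ... | inj₁ 1+1≡0 = ⊥-elim (-1≢x² 1# (trans (*-identityʳ 1#) (+-inverseʳ-unique 1# 1# 1+1≡0)))
    ... | inj₂ x≡0   = x≡0

    positive : Fin q → Bool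
    positive x = x <ᵇ - x

    positive⇒≢0 : ∀ {x} → positive x ≡ true → ¬ (x ≡ 0#)
    positive⇒≢0 x>0 refl = case trans (sym x>0) (trans (cong (0# <ᵇ_) -0#≈0#) (<ᵇ-irrefl 0#)) of λ ()

    positive-neg : ∀ {x} → ¬ (x ≡ 0#) → positive (- x) ≡ not (positive x)
    positive-neg {x} x≢0 = begin
      (- x <ᵇ - (- x))  ≡⟨ cong (- x <ᵇ_) (-‿involutive x) ⟩
      (- x <ᵇ x)        ≡⟨ <ᵇ-flip (x≢0 ∘ x≡-x⇒x≡0) ⟩
      not (positive x)  ∎

    rep : Fin q → Fin q
    rep x = if positive x then x else - x

    rep-positive : ∀ {x} → ¬ (x ≡ 0#) → positive (rep x) ≡ true
    rep-positive {x} x≢0 with positive x in eq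
    ... | true  = eq
    ... | false = trans (positive-neg x≢0) (cong not eq)

    rep-of-positive : ∀ x → positive x ≡ true → rep x ≡ x
    rep-of-positive x x>0 = cong (λ b → if b then x else - x) x>0

    rep-neg : ∀ {x} → ¬ (x ≡ 0#) → rep (- x) ≡ rep x
    rep-neg {x} x≢0 rewrite positive-neg x≢0 with positive x
    ... | true  = -‿involutive x
    ... | false = refl

    rep-± : ∀ x → rep x ≡ x ⊎ rep x ≡ - x
    rep-± x with positive x
    ... | true  = inj₁ refl
    ... | false = inj₂ refl

    rep-⁻¹-rep : ∀ {x} → ¬ (x ≡ 0#) → rep (rep x ⁻¹) ≡ rep (x ⁻¹)
    rep-⁻¹-rep {x} x≢0 with rep-± x
    ... | inj₁ rx≡x  = cong (λ y → rep (y ⁻¹)) rx≡x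
    ... | inj₂ rx≡-x = begin
      rep (rep x ⁻¹)  ≡⟨ cong (λ y → rep (y ⁻¹)) rx≡-x ⟩
      rep ((- x) ⁻¹)  ≡⟨ cong rep (⁻¹-neg x≢0) ⟩
      rep (- (x ⁻¹))  ≡⟨ rep-neg (⁻¹-nonzero x≢0) ⟩
      rep (x ⁻¹)      ∎

    φ : Fin q → Fin q
    φ x = if positive x then rep (x ⁻¹) else x

    φ-positive : ∀ x → positive x ≡ true → φ x ≡ rep (x ⁻¹)
    φ-positive x x>0 = cong (λ b → if b then rep (x ⁻¹) else x) x>0

    φ-nonpositive : ∀ x → positive x ≡ false → φ x ≡ x
    φ-nonpositive x x≯0 = cong (λ b → if b then rep (x ⁻¹) else x) x≯0

    positive-φ : ∀ x → positive (φ x) ≡ positive x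
    positive-φ x with positive x in eq
    ... | true  = rep-positive (⁻¹-nonzero (positive⇒≢0 eq))
    ... | false = eq

    φ-involutive : ∀ x → φ (φ x) ≡ x
    φ-involutive x with positive x in eq
    ... | false = φ-nonpositive x eq
    ... | true  = begin
      φ (rep (x ⁻¹))       ≡⟨ φ-positive (rep (x ⁻¹)) (rep-positive x⁻¹≢0) ⟩
      rep (rep (x ⁻¹) ⁻¹)  ≡⟨ rep-⁻¹-rep x⁻¹≢0 ⟩
      rep (x ⁻¹ ⁻¹)        ≡⟨ cong rep (⁻¹-involutive x≢0) ⟩
      rep x                ≡⟨ rep-of-positive x eq ⟩
      x                    ∎
      where
      x≢0 = positive⇒≢0 eq
      x⁻¹≢0 = ⁻¹-nonzero x≢0

    φ-fixed⇔≡rep1 : ∀ {x} → positive x ≡ true → (φ x ≡ x) ⇔ (x ≡ rep 1#)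
    φ-fixed⇔≡rep1 {x} x>0 = mk⇔ to from
      where
      x≢0 = positive⇒≢0 x>0
      rep[x⁻¹]≡x : φ x ≡ x → rep (x ⁻¹) ≡ x
      rep[x⁻¹]≡x = trans (sym (φ-positive x x>0))
      ±1⇒≡rep1 : x ≡ 1# ⊎ x ≡ - 1# → x ≡ rep 1#
      ±1⇒≡rep1 (inj₁ x≡1)  = trans (sym (rep-of-positive x x>0)) (cong rep x≡1)
      ±1⇒≡rep1 (inj₂ x≡-1) = trans (sym (rep-of-positive x x>0)) (trans (cong rep x≡-1) (rep-neg 1≢0))
      to : φ x ≡ x → x ≡ rep 1#
      to φx≡x with rep-± (x ⁻¹)
      ... | inj₁ r≡x⁻¹  = ±1⇒≡rep1 (x*x≡1⇒x≡±1 (begin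
        x * x       ≡⟨ cong (x *_) (trans (sym (rep[x⁻¹]≡x φx≡x)) r≡x⁻¹) ⟩
        x * x ⁻¹    ≡⟨ inverseʳ x x≢0 ⟩
        1#          ∎))
      ... | inj₂ r≡-x⁻¹ = ⊥-elim (-1≢x² x (begin
        x * x         ≡⟨ cong (x *_) (trans (sym (rep[x⁻¹]≡x φx≡x)) r≡-x⁻¹) ⟩
        x * - (x ⁻¹)  ≡⟨ -‿distribʳ-* x (x ⁻¹) ⟨
        - (x * x ⁻¹)  ≡⟨ cong -_ (inverseʳ x x≢0) ⟩
        - 1#          ∎))
      φ[rep1]≡rep1 : φ (rep 1#) ≡ rep 1#
      φ[rep1]≡rep1 = begin
        φ (rep 1#)       ≡⟨ φ-positive (rep 1#) (rep-positive 1≢0) ⟩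
        rep (rep 1# ⁻¹)  ≡⟨ rep-⁻¹-rep 1≢0 ⟩
        rep (1# ⁻¹)      ≡⟨ cong rep 1⁻¹≡1 ⟩
        rep 1#           ∎
      from : x ≡ rep 1# → φ x ≡ x
      from x≡rep1 = trans (cong φ x≡rep1) (trans φ[rep1]≡rep1 (sym x≡rep1))

    q≡1+2·count-positive : q ≡ 1 ℕ.+ (count positive ℕ.+ count positive)
    q≡1+2·count-positive = begin
      q                                  ≡⟨ count-true ⟨
      count {q} (λ _ → true)             ≡⟨ count-involution -_ -‿involutive (λ _ → true) (λ _ → refl) ⟩
      count (λ x → does (- x ≟ x)) ℕ.+ (count positive ℕ.+ count positive)
        ≡⟨ cong (ℕ._+ (count positive ℕ.+ count positive)) (trans (count-cong -x≟x≗x≟0) (count-≟ 0#)) ⟩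
      1 ℕ.+ (count positive ℕ.+ count positive) ∎
      where
      -x≟x≗x≟0 : ∀ x → does (- x ≟ x) ≡ does (x ≟ 0#)
      -x≟x≗x≟0 x = does-⇔ (mk⇔ (x≡-x⇒x≡0 ∘ sym) (λ x≡0 → trans (cong -_ x≡0) (trans -0#≈0# (sym x≡0))))
                          (- x ≟ x) (x ≟ 0#)

    count-positive-odd : ∃ λ l → count positive ≡ 1 ℕ.+ (l ℕ.+ l)
    count-positive-odd = l , trans (count-involution φ φ-involutive positive positive-φ)
      (cong (ℕ._+ (l ℕ.+ l)) (trans (count-cong fixed≗≡rep1) (count-≟ (rep 1#))))
      where
      l = count (λ x → positive x ∧ (x <ᵇ φ x))
      fixed≗≡rep1 : ∀ x → (positive x ∧ does (φ x ≟ x)) ≡ does (x ≟ rep 1#)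
      fixed≗≡rep1 x = by-positivity (positive x) refl
        where
        by-positivity : ∀ b → positive x ≡ b → (b ∧ does (φ x ≟ x)) ≡ does (x ≟ rep 1#)
        by-positivity true  x>0 = does-⇔ (φ-fixed⇔≡rep1 x>0) (φ x ≟ x) (x ≟ rep 1#)
        by-positivity false x≯0 = sym (dec-false (x ≟ rep 1#) λ x≡rep1 →
          case trans (sym x≯0) (trans (cong positive x≡rep1) (rep-positive 1≢0)) of λ ())

    q%4≡3 : q % 4 ≡ 3
    q%4≡3 with count-positive-odd
    ... | l , h≡1+2l = begin
      q % 4
        ≡⟨ cong (_% 4) (trans q≡1+2·count-positive (cong (λ h → 1 ℕ.+ (h ℕ.+ h)) h≡1+2l)) ⟩
      (1 ℕ.+ ((1 ℕ.+ (l ℕ.+ l)) ℕ.+ (1 ℕ.+ (l ℕ.+ l)))) % 4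
        ≡⟨ cong (_% 4) (1+2[1+2l]≡3+4l l) ⟩
      (3 ℕ.+ l ℕ.* 4) % 4
        ≡⟨ [m+kn]%n≡m%n 3 l 4 ⟩
      3 ∎
      where
      1+2[1+2l]≡3+4l : ∀ l → 1 ℕ.+ ((1 ℕ.+ (l ℕ.+ l)) ℕ.+ (1 ℕ.+ (l ℕ.+ l))) ≡ 3 ℕ.+ l ℕ.* 4
      1+2[1+2l]≡3+4l = solve-∀

  module Characteristic3 (3×ᵣ1≡0 : 3 ×ᵣ 1# ≡ 0#) where
    open MatrixProperties F
    open ≡-Reasoning

    1+[1+1]≡0 : 1# + (1# + 1#) ≡ 0#
    1+[1+1]≡0 = trans (cong (λ z → 1# + (1# + z)) (sym (+-identityʳ 1#))) 3×ᵣ1≡0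

    1+1≡-1 : 1# + 1# ≡ - 1#
    1+1≡-1 = +-inverseʳ-unique 1# (1# + 1#) 1+[1+1]≡0

    -1+-1≡1 : - 1# + - 1# ≡ 1#
    -1+-1≡1 = begin
      - 1# + - 1#            ≡⟨ cong₂ _+_ 1+1≡-1 1+1≡-1 ⟨
      (1# + 1#) + (1# + 1#)  ≡⟨ +-assoc 1# 1# (1# + 1#) ⟩
      1# + (1# + (1# + 1#))  ≡⟨ cong (1# +_) 1+[1+1]≡0 ⟩
      1# + 0#                ≡⟨ +-identityʳ 1# ⟩
      1#                     ∎

    fromℤ₃ : ℤ₃ → Fin q
    fromℤ₃ 0₃ = 0#
    fromℤ₃ 1₃ = 1#
    fromℤ₃ 2₃ = - 1#

    +-homo : ∀ x y → fromℤ₃ (x +₃ y) ≡ fromℤ₃ x + fromℤ₃ y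
    +-homo 0₃ y  = sym (+-identityˡ (fromℤ₃ y))
    +-homo 1₃ 0₃ = sym (+-identityʳ 1#)
    +-homo 1₃ 1₃ = sym 1+1≡-1
    +-homo 1₃ 2₃ = sym (-‿inverseʳ 1#)
    +-homo 2₃ 0₃ = sym (+-identityʳ (- 1#))
    +-homo 2₃ 1₃ = sym (-‿inverseˡ 1#)
    +-homo 2₃ 2₃ = sym -1+-1≡1

    *-homo : ∀ x y → fromℤ₃ (x *₃ y) ≡ fromℤ₃ x * fromℤ₃ y
    *-homo 0₃ y  = sym (zeroˡ (fromℤ₃ y))
    *-homo 1₃ y  = sym (*-identityˡ (fromℤ₃ y))
    *-homo 2₃ 0₃ = sym (zeroʳ (- 1#))
    *-homo 2₃ 1₃ = sym (*-identityʳ (- 1#))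
    *-homo 2₃ 2₃ = trans (sym (*-identityˡ 1#)) (sym (-x*-y≡x*y 1# 1#))

    -‿homo : ∀ x → fromℤ₃ (-₃ x) ≡ - (fromℤ₃ x)
    -‿homo 0₃ = sym -0#≈0#
    -‿homo 1₃ = refl
    -‿homo 2₃ = sym (-‿involutive 1#)

    homomorphism : ℤ₃-rawRing -Raw-AlmostCommutative⟶ fromCommutativeRing commutativeRing
    homomorphism = record
      { ⟦_⟧ = fromℤ₃ ; +-homo = +-homo ; *-homo = *-homo ; -‿homo = -‿homo ; 0-homo = refl ; 1-homo = refl }

    fromℤ₃-weaklyDecidable : ∀ x y → Maybe (fromℤ₃ x ≡ fromℤ₃ y)
    fromℤ₃-weaklyDecidable 0₃ 0₃ = just refl
    fromℤ₃-weaklyDecidable 1₃ 1₃ = just refl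
    fromℤ₃-weaklyDecidable 2₃ 2₃ = just refl
    fromℤ₃-weaklyDecidable _  _  = nothing

    open RingSolver ℤ₃-rawRing (fromCommutativeRing commutativeRing) homomorphism fromℤ₃-weaklyDecidable

    trace : Mat → Fin q
    trace (mat a _ _ d) = a + d

    det-· : ∀ A B → det (A · B) ≡ det A * det B
    det-· (mat a b c d) (mat a′ b′ c′ d′) = solve 8 (λ a b c d a′ b′ c′ d′ →
      (a :* a′ :+ b :* c′) :* (c :* b′ :+ d :* d′) :- (a :* b′ :+ b :* d′) :* (c :* a′ :+ d :* c′)
        := (a :* d :- b :* c) :* (a′ :* d′ :- b′ :* c′)) refl a b c d a′ b′ c′ d′

    Inv-· : ∀ {A B} → Inv A → Inv B → Inv (A · B)
    Inv-· {A} {B} A-inv B-inv detAB≡0 = x≢0∧y≢0⇒x*y≢0 A-inv B-inv (trans (sym (det-· A B)) detAB≡0)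

    adj : Mat → Mat
    adj (mat a b c d) = mat d (- b) (- c) a

    Inv-adj : ∀ {A} → Inv A → Inv (adj A)
    Inv-adj {mat a b c d} A-inv det≡0 = A-inv (trans (solve 4 (λ a b c d →
      a :* d :- b :* c := d :* a :- (:- b) :* (:- c)) refl a b c d) det≡0)

    I₂~adj·A : ∀ {A} → Inv A → I₂ ~ (adj A · A)
    I₂~adj·A {mat a b c d} A-inv = det (mat a b c d) , A-inv , mat-cong
      (solve 4 (λ a b c d → d :* a :+ (:- b) :* c := (a :* d :- b :* c) :* con 1₃) refl a b c d)
      (solve 4 (λ a b c d → d :* b :+ (:- b) :* d := (a :* d :- b :* c) :* con 0₃) refl a b c d)
      (solve 4 (λ a b c d → (:- c) :* a :+ a :* c := (a :* d :- b :* c) :* con 0₃) refl a b c d)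
      (solve 4 (λ a b c d → (:- c) :* b :+ a :* d := (a :* d :- b :* c) :* con 1₃) refl a b c d)

    -- A non-scalar M is linearly independent of I₂, so κ M + μ I₂ is scalar only if κ = 0.
    nonscalar-coefficient≡0 : ∀ {a b c d a′ b′ c′ d′} κ → Inv (mat a b c d) → ¬ (mat a b c d ~ I₂) →
      mat a′ b′ c′ d′ ~ I₂ → b′ ≡ κ * b → c′ ≡ κ * c → a′ + - d′ ≡ κ * (a + - d) → κ ≡ 0#
    nonscalar-coefficient≡0 {a} {b} {c} {d} {a′} {b′} {c′} {d′}
      κ M-inv M≁I₂ N~I₂ b′≡κb c′≡κc a′-d′≡κ[a-d]
      with κ ≟ 0# | ~I₂⇒scalar N~I₂
    ... | yes κ≡0 | _                   = κ≡0
    ... | no  κ≢0 | b′≡0 , c′≡0 , a′≡d′ = ⊥-elim (M≁I₂ (scalar⇒~I₂ M-inv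
            (vanish b (trans (sym b′≡κb) b′≡0))
            (vanish c (trans (sym c′≡κc) c′≡0))
            (x∙y⁻¹≈ε⇒x≈y a d (vanish (a + - d) (begin
              κ * (a + - d)  ≡⟨ a′-d′≡κ[a-d] ⟨
              a′ + - d′      ≡⟨ cong (_+ - d′) a′≡d′ ⟩
              d′ + - d′      ≡⟨ -‿inverseʳ d′ ⟩
              0#             ∎)))))
      where
      vanish : ∀ x → κ * x ≡ 0# → x ≡ 0#
      vanish x κx≡0 = *-cancelˡ-nonzero κ κ≢0 (trans κx≡0 (sym (zeroʳ κ)))

    -- M² = (tr M) M - (det M) I₂
    involution⇒trace≡0 : ∀ {M} → Inv M → (M · M) ~ I₂ → ¬ (M ~ I₂) → trace M ≡ 0#
    involution⇒trace≡0 {mat a b c d} M-inv M²~I₂ M≁I₂ = nonscalar-coefficient≡0 (a + d) M-inv M≁I₂ M²~I₂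
      (solve 4 (λ a b c d → a :* b :+ b :* d := (a :+ d) :* b) refl a b c d)
      (solve 4 (λ a b c d → c :* a :+ d :* c := (a :+ d) :* c) refl a b c d)
      (solve 4 (λ a b c d → (a :* a :+ b :* c) :- (c :* b :+ d :* d) := (a :+ d) :* (a :- d)) refl a b c d)

    -- M³ = ((tr M)² - det M) M - (tr M) (det M) I₂
    order3⇒trace²≡det : ∀ {M} → Inv M → ((M · M) · M) ~ I₂ → ¬ (M ~ I₂) → trace M * trace M ≡ det M
    order3⇒trace²≡det {mat a b c d} M-inv M³~I₂ M≁I₂ =
      x∙y⁻¹≈ε⇒x≈y _ _ (nonscalar-coefficient≡0 _ M-inv M≁I₂ M³~I₂
        (solve 4 (λ a b c d → (a :* a :+ b :* c) :* b :+ (a :* b :+ b :* d) :* d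
                   := ((a :+ d) :* (a :+ d) :- (a :* d :- b :* c)) :* b) refl a b c d)
        (solve 4 (λ a b c d → (c :* a :+ d :* c) :* a :+ (c :* b :+ d :* d) :* c
                   := ((a :+ d) :* (a :+ d) :- (a :* d :- b :* c)) :* c) refl a b c d)
        (solve 4 (λ a b c d → ((a :* a :+ b :* c) :* a :+ (a :* b :+ b :* d) :* c)
                              :- ((c :* a :+ d :* c) :* b :+ (c :* b :+ d :* d) :* d)
                   := ((a :+ d) :* (a :+ d) :- (a :* d :- b :* c)) :* (a :- d)) refl a b c d))

    -- In characteristic 3 the polar form 2ae + bg + cf of a² + bc equals cf - ae + bg.
    isotropic-orthogonal⇒square : ∀ a b c e f g → e * e + f * g ≡ 0# → c * f + - (a * e) + b * g ≡ 0# →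
      ¬ (e ≡ 0# × f ≡ 0# × g ≡ 0#) → ∃ λ α → a * a + b * c ≡ α * α
    isotropic-orthogonal⇒square a b c e f g isotropic orthogonal nonzero with f ≟ 0#
    ... | no f≢0 = u * f ⁻¹ , *-cancelˡ-nonzero (f * f) (x≢0∧y≢0⇒x*y≢0 f≢0 f≢0) (begin
      f * f * (a * a + b * c)
        ≡⟨ solve 6 (λ a b c e f g → f :* f :* (a :* a :+ b :* c)
             := (a :* f :- b :* e) :* (a :* f :- b :* e) :+ b :* f :* (c :* f :- a :* e :+ b :* g)
                :- b :* b :* (e :* e :+ f :* g)) refl a b c e f g ⟩
      u * u + b * f * (c * f + - (a * e) + b * g) + - (b * b * (e * e + f * g))
        ≡⟨ cong₂ (λ o i → u * u + b * f * o + - (b * b * i)) orthogonal isotropic ⟩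
      u * u + b * f * 0# + - (b * b * 0#)
        ≡⟨ solve 3 (λ u b f → u :* u :+ b :* f :* con 0₃ :- b :* b :* con 0₃
             := u :* u :* (con 1₃ :* con 1₃)) refl u b f ⟩
      u * u * (1# * 1#)
        ≡⟨ cong (λ o → u * u * (o * o)) (inverseʳ f f≢0) ⟨
      u * u * (f * f ⁻¹ * (f * f ⁻¹))
        ≡⟨ solve 3 (λ u f i → u :* u :* (f :* i :* (f :* i)) := f :* f :* (u :* i :* (u :* i))) refl u f (f ⁻¹) ⟩
      f * f * (u * f ⁻¹ * (u * f ⁻¹)) ∎)
      where
      u = a * f + - (b * e)
    ... | yes f≡0 = a , (begin
      a * a + b * c   ≡⟨ cong (λ b → a * a + b * c) b≡0 ⟩
      a * a + 0# * c  ≡⟨ solve 2 (λ a c → a :* a :+ con 0₃ :* c := a :* a) refl a c ⟩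
      a * a           ∎)
      where
      e≡0 : e ≡ 0#
      e≡0 = reduce (x*y≡0⇒x≡0⊎y≡0 e e (begin
        e * e           ≡⟨ solve 2 (λ e g → e :* e := e :* e :+ con 0₃ :* g) refl e g ⟩
        e * e + 0# * g  ≡⟨ cong (λ f → e * e + f * g) f≡0 ⟨
        e * e + f * g   ≡⟨ isotropic ⟩
        0#              ∎))
      b≡0 : b ≡ 0#
      b≡0 with x*y≡0⇒x≡0⊎y≡0 b g (begin
        b * g
          ≡⟨ solve 4 (λ a b c g → b :* g := c :* con 0₃ :- a :* con 0₃ :+ b :* g) refl a b c g ⟩
        c * 0# + - (a * 0#) + b * g
          ≡⟨ cong₂ (λ f e → c * f + - (a * e) + b * g) f≡0 e≡0 ⟨
        c * f + - (a * e) + b * g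
          ≡⟨ orthogonal ⟩
        0# ∎)
      ... | inj₁ b≡0 = b≡0
      ... | inj₂ g≡0 = ⊥-elim (nonzero (e≡0 , f≡0 , g≡0))

    -- r = mat x y z w is unipotent up to scalars, so (w - x, y, z) is isotropic; it is orthogonal
    -- to t = mat a b c (- a) because tr (t r) = 0.
    involution-inverting-order3⇒det≡-square : ∀ {t r} →
      Inv t → (t · t) ~ I₂ → ¬ (t ~ I₂) →
      Inv r → ((r · r) · r) ~ I₂ → ¬ (r ~ I₂) →
      Inv (t · r) → ((t · r) · (t · r)) ~ I₂ → ¬ ((t · r) ~ I₂) →
      ∃ λ α → det t ≡ - (α * α)
    involution-inverting-order3⇒det≡-square {mat a b c d} {mat x y z w}
      t-inv t²~I₂ t≁I₂ r-inv r³~I₂ r≁I₂ tr-inv [tr]²~I₂ tr≁I₂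
      with +-inverseʳ-unique a d (involution⇒trace≡0 t-inv t²~I₂ t≁I₂)
    ... | refl = map₂ (λ {α} a²+bc≡α² → begin
        a * - a + - (b * c)  ≡⟨ solve 3 (λ a b c → a :* (:- a) :- b :* c := :- (a :* a :+ b :* c)) refl a b c ⟩
        - (a * a + b * c)    ≡⟨ cong -_ a²+bc≡α² ⟩
        - (α * α)            ∎)
      (isotropic-orthogonal⇒square a b c (w + - x) y z isotropic orthogonal nonzero)
      where
      isotropic : (w + - x) * (w + - x) + y * z ≡ 0#
      isotropic = trans
        (solve 4 (λ x y z w → (w :- x) :* (w :- x) :+ y :* z
                   := (x :+ w) :* (x :+ w) :- (x :* w :- y :* z)) refl x y z w)
        (x≈y⇒x∙y⁻¹≈ε (order3⇒trace²≡det r-inv r³~I₂ r≁I₂))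
      orthogonal : c * y + - (a * (w + - x)) + b * z ≡ 0#
      orthogonal = trans
        (solve 7 (λ a b c x y z w → c :* y :- a :* (w :- x) :+ b :* z
                   := (a :* x :+ b :* z) :+ (c :* y :+ (:- a) :* w)) refl a b c x y z w)
        (involution⇒trace≡0 tr-inv [tr]²~I₂ tr≁I₂)
      nonzero : ¬ ((w + - x) ≡ 0# × y ≡ 0# × z ≡ 0#)
      nonzero (w-x≡0 , y≡0 , z≡0) = r≁I₂ (scalar⇒~I₂ r-inv y≡0 z≡0 (sym (x∙y⁻¹≈ε⇒x≈y w x w-x≡0)))

    module _ {n : ℕ} (X : Graph n) (act : PGLisAut F X)
      (2-arc-regular : Regular2Arcs F X act Inv) (PSL-arc-regular : PSLArcRegular F X act) where
      open Action F X act 2-arc-regular PSL-arc-regular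
      open PGLisAut act

      ρ-injective : ∀ {A} → Inv A → ∀ {x y} → ρ A x ≡ ρ A y → x ≡ y
      ρ-injective {A} A-inv {x} {y} Ax≡Ay = trans (sym (undo x)) (trans (cong (ρ (adj A)) Ax≡Ay) (undo y))
        where
        undo : ∀ z → ρ (adj A) (ρ A z) ≡ z
        undo z = trans (sym (ρ-hom (adj A) A (Inv-adj A-inv) A-inv z))
          (trans (sym (ρ-resp I₂ (adj A · A) Inv-I₂ (Inv-· (Inv-adj A-inv) A-inv) (I₂~adj·A A-inv) z)) (ρ-id z))

      module _ {v : Fin n} (N : Neighbourhood X v) where
        open Neighbourhood N

        module SwapAndRotation {t r : Mat}
          (t-inv : Inv t) (t-a : ρ t a ≡ b) (t-v : ρ t v ≡ v) (t-c : ρ t c ≡ c)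
          (r-inv : Inv r) (r-a : ρ r a ≡ b) (r-v : ρ r v ≡ v) (r-b : ρ r b ≡ c) where

          t-b : ρ t b ≡ a
          t-b with only (stabiliser-preserves-neighbourhood N t-inv t-v v~b)
          ... | inj₁ tb≡a        = tb≡a
          ... | inj₂ (inj₁ tb≡b) = ⊥-elim (a≢b (ρ-injective t-inv (trans t-a (sym tb≡b))))
          ... | inj₂ (inj₂ tb≡c) = ⊥-elim (b≢c (ρ-injective t-inv (trans tb≡c (sym t-c))))

          r-c : ρ r c ≡ a
          r-c with only (stabiliser-preserves-neighbourhood N r-inv r-v v~c)
          ... | inj₁ rc≡a        = rc≡a
          ... | inj₂ (inj₁ rc≡b) = ⊥-elim (a≢c (ρ-injective r-inv (trans r-a (sym rc≡b))))
          ... | inj₂ (inj₂ rc≡c) = ⊥-elim (b≢c (ρ-injective r-inv (trans r-b (sym rc≡c))))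

          t²~I₂ : (t · t) ~ I₂
          t²~I₂ = fixes-2-arc⇒~I₂ (2-arc N v~a v~c a≢c) (Inv-· t-inv t-inv)
            (·-maps t-inv t-inv t-a t-b) (·-maps t-inv t-inv t-v t-v) (·-maps t-inv t-inv t-c t-c)

          t≁I₂ : ¬ (t ~ I₂)
          t≁I₂ = moves⇒≁I₂ t-inv (λ ta≡a → a≢b (trans (sym ta≡a) t-a))

          r²-inv : Inv (r · r)
          r²-inv = Inv-· r-inv r-inv

          r³~I₂ : ((r · r) · r) ~ I₂
          r³~I₂ = fixes-2-arc⇒~I₂ (2-arc N v~a v~b a≢b) (Inv-· r²-inv r-inv)
            (·-maps r²-inv r-inv r-a (·-maps r-inv r-inv r-b r-c))
            (·-maps r²-inv r-inv r-v (·-maps r-inv r-inv r-v r-v))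
            (·-maps r²-inv r-inv r-b (·-maps r-inv r-inv r-c r-a))

          r≁I₂ : ¬ (r ~ I₂)
          r≁I₂ = moves⇒≁I₂ r-inv (λ ra≡a → a≢b (trans (sym ra≡a) r-a))

          tr-inv : Inv (t · r)
          tr-inv = Inv-· t-inv r-inv

          tr-a : ρ (t · r) a ≡ a
          tr-a = ·-maps t-inv r-inv r-a t-b

          tr-b : ρ (t · r) b ≡ c
          tr-b = ·-maps t-inv r-inv r-b t-c

          [tr]²~I₂ : ((t · r) · (t · r)) ~ I₂
          [tr]²~I₂ = fixes-2-arc⇒~I₂ (2-arc N v~a v~b a≢b) (Inv-· tr-inv tr-inv)
            (·-maps tr-inv tr-inv tr-a tr-a)
            (·-maps tr-inv tr-inv (·-maps t-inv r-inv r-v t-v) (·-maps t-inv r-inv r-v t-v))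
            (·-maps tr-inv tr-inv tr-b (·-maps t-inv r-inv r-c t-a))

          tr≁I₂ : ¬ ((t · r) ~ I₂)
          tr≁I₂ = moves⇒≁I₂ tr-inv (λ trb≡b → b≢c (trans (sym trb≡b) tr-b))

          t∉PSL : ¬ (InPSL t)
          t∉PSL t∈PSL = t≁I₂ (PSL-fixes-arc⇒~I₂ v~c t-inv t∈PSL t-v t-c)

          -1≢x² : ∀ x → ¬ (x * x ≡ - 1#)
          -1≢x² x x²≡-1 =
            case involution-inverting-order3⇒det≡-square
                   t-inv t²~I₂ t≁I₂ r-inv r³~I₂ r≁I₂ tr-inv [tr]²~I₂ tr≁I₂ of λ
              { (α , det≡-α²) → t∉PSL (x * α , (begin
                  det t            ≡⟨ det≡-α² ⟩
                  - (α * α)        ≡⟨ -1*x≈-x (α * α) ⟨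
                  - 1# * (α * α)   ≡⟨ cong (_* (α * α)) x²≡-1 ⟨
                  x * x * (α * α)  ≡⟨ solve 2 (λ x α → x :* x :* (α :* α) := x :* α :* (x :* α)) refl x α ⟩
                  x * α * (x * α)  ∎)) }

        -1≢x² : ∀ x → ¬ (x * x ≡ - 1#)
        -1≢x² with proj₁ (2-arc-regular a v c b v c (2-arc N v~a v~c a≢c) (2-arc N v~b v~c b≢c))
                 | proj₁ (2-arc-regular a v b b v c (2-arc N v~a v~b a≢b) (2-arc N v~b v~c b≢c))
        ... | t , t-inv , t-a , t-v , t-c | r , r-inv , r-a , r-v , r-b =
          SwapAndRotation.-1≢x² t-inv t-a t-v t-c r-inv r-a r-v r-b

some-vertex : ∀ {q n} {F : FiniteField q} {X : Graph n} → PGLisAut F X → Fin n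
some-vertex {n = suc _} _ = Fin.zero
some-vertex {n = zero} {F} act =
  ⊥-elim (1≢0 (proj₁ (~I₂⇒scalar (faithful (mat 1# 1# 0# 1#) (Inv-unitriangular 1#) λ ()))))
  where
  open FieldProperties F
  open MatrixProperties F
  open PGLisAut act

-- Only 2-arc-regularity of PGL(2,q) and arc-regularity of PSL(2,q) are used.
lemma3p2 : (p k : ℕ) → Prime p → ¬ (p ≡ 2) → 1 ≤ k →
           (F : FiniteField (p ^ k)) →
           {n : ℕ} (X : Graph n) → Cubic X → Connected X →
           (act : PGLisAut F X) →
           Type1-2¹ F X act →
           PSLArcRegular F X act →
           ((v : Fin n) → ¬ StabInPSL F X act v)
           × (p ≡ 3 → Odd k)
lemma3p2 p k _ _ _ F X cubic _ act (2-arc-regular , _) PSL-arc-regular =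
    (λ v → stabiliser-⊈-PSL (neighbourhood X cubic v))
  , λ { refl → 3^k%4≡3⇒odd k (q%4≡3 (^×ᵣ1≡0⇒×ᵣ1≡0 3 k q×ᵣ1≡0)) }
  where
  open FieldProperties F
  open Action F X act 2-arc-regular PSL-arc-regular
  q%4≡3 : 3 ×ᵣ 1# ≡ 0# → p ^ k % 4 ≡ 3
  q%4≡3 3×ᵣ1≡0 = MinusOneNonSquare.q%4≡3 F
    (Characteristic3.-1≢x² F 3×ᵣ1≡0 X act 2-arc-regular PSL-arc-regular (neighbourhood X cubic (some-vertex act)))
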